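{- For integers $m>l\geq 2$ and $p\geq 2$ let $A_{l,m}(p)=(a_0,a_1,\ldots,a_m)$ where $a_i=i+1$ for $0\leq i\leq l-1$ and $a_{l+i}=((i+1)p-i)\,l$ for $0\leq i\leq m-l$; that is, $A_{l,m}(p)=(1,2,\ldots,l,\ pl,\ (2p-1)l,\ (3p-2)l,\ldots,((m-l+1)p-(m-l))l)$. Then $A_{l,m}(p)$ is an orderly currency. Moreover, if $p>m-l$ then $\lceil a_m/a_l\rceil=m-l+1$.
   Context: A currency is a finite sequence of integers $A=(a_0,a_1,\ldots,a_k)$ with $1=a_0<a_1<\cdots<a_k$. For an integer amount $c>0$, $\mathrm{opt}_A(c)$ is the minimum number of coins (values from $A$, repetitions allowed) summing to $c$, and $\mathrm{grd}_A(c)$ is the number of coins used by the greedy algorithm, which repeatedly takes the largest coin not exceeding the remaining amount. $A$ is orderly if $\mathrm{opt}_A(c)=\mathrm{grd}_A(c)$ for all integers $c>0$. -}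

module Defs where

open import Data.Nat using (ℕ; zero; suc; _+_; _*_; _∸_; _≤_; _<_; _<ᵇ_; _≤?_; _/_)
open import Data.Nat.Properties using ()
open import Data.List using (List; []; _∷_; length; map; upTo)
open import Data.Nat.ListAction using (sum)
open import Data.Empty using (⊥)
open import Data.List.Membership.Propositional using (_∈_)
open import Data.List.Relation.Unary.All using (All)
open import Data.List.Relation.Unary.Linked using (Linked)
open import Data.Product using (_×_; Σ-syntax)
open import Data.Bool using (if_then_else_)
open import Relation.Nullary using (yes; no)
open import Relation.Binary.PropositionalEquality using (_≡_)

IsCurrency : List ℕ → Set
IsCurrency []      = ⊥
IsCurrency (a ∷ as) = (a ≡ 1) × Linked _<_ (a ∷ as)

IsRep : List ℕ → ℕ → List ℕ → Set
IsRep A c xs = All (_∈ A) xs × sum xs ≡ c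

IsOpt : List ℕ → ℕ → ℕ → Set
IsOpt A c n = (Σ[ xs ∈ List ℕ ] (IsRep A c xs × length xs ≡ n))
            × (∀ xs → IsRep A c xs → n ≤ length xs)

-- largest coin of A not exceeding r (0 if none)
largestLE : List ℕ → ℕ → ℕ
largestLE []       r = 0
largestLE (a ∷ as) r with a ≤? r
... | no  _ = largestLE as r
... | yes _ = let b = largestLE as r in if b <ᵇ a then a else b

grdF : ℕ → List ℕ → ℕ → ℕ
grdF zero     A r       = 0
grdF (suc f)  A zero    = 0
grdF (suc f)  A (suc r) = suc (grdF f A (suc r ∸ largestLE A (suc r)))

-- grd_A(c); fuel c suffices since a₀ = 1 makes every step remove ≥ 1.
grd : List ℕ → ℕ → ℕ
grd A c = grdF c A c

Orderly : List ℕ → Set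
Orderly A = ∀ c → 0 < c → IsOpt A c (grd A c)

coinA : ℕ → ℕ → ℕ → ℕ
coinA l p i = if i <ᵇ l then suc i else ((suc (i ∸ l)) * p ∸ (i ∸ l)) * l

currA : ℕ → ℕ → ℕ → List ℕ
currA l m p = map (coinA l p) (upTo (suc m))

-- ⌈a / b⌉ for b > 0 (set to 0 when b = 0; never used then)
ceilDiv : ℕ → ℕ → ℕ
ceilDiv a zero    = 0
ceilDiv a (suc b) = (a + b) / suc b

module Submission where

-- Write l = l₀ + 1, q = p - 1 and K = m - l + 1, so that
-- A = (1, 2, …, l₀, l·1, l·(1+q), l·(1+2q), …, l·(1+Kq)).  Every amount x has digits
-- x = y·l + r (r < l) and y = t·C + s (s < C) with C = 1 + Kq, and we set
--   F x = t + h s + [r > 0],   h 0 = 0,  h (s+1) = 1 + (s mod q).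
-- F is a certificate of orderliness (GreedyCertificate): F 0 = 0, F obeys the
-- greedy recursion F x = 1 + F (x - largest coin ≤ x), hence F = grd; and adding
-- any coin raises F by at most one, hence F (sum of a representation) ≤ its
-- length, i.e. F ≤ opt.  Both properties are checked layer by layer: G y =
-- t + h s handles the scaled coins 1 + jq (Layer), and F adds the digit r for
-- the coins 1, …, l₀ (Orderliness).  All of this only needs l ≥ 1, l ≤ m and p ≥ 2.

open import Defs
open import Data.Nat using (ℕ; _<_; _≤_)
open import Data.Product using (_×_)
open import Relation.Binary.PropositionalEquality using (_≡_)
open import Data.Nat using (_∸_; _+_)

open import Data.Nat
open import Data.Nat.Properties
open import Data.Nat.DivMod
open import Data.Nat.Divisibility using (n∣m*n)
open import Data.Nat.ListAction using (sum)
open import Data.Nat.Tactic.RingSolver using (solve-∀)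
open import Data.Bool using (true; false; if_then_else_; T)
open import Data.Bool.Properties using (T-≡)
open import Data.Unit using (tt)
open import Data.List using (List; []; _∷_; length; map; upTo; applyUpTo)
open import Data.List.Properties using (map-applyUpTo)
open import Data.List.Membership.Propositional using (_∈_)
open import Data.List.Membership.Propositional.Properties using (∈-map⁺; ∈-map⁻; ∈-upTo⁺; ∈-upTo⁻)
open import Data.List.Relation.Unary.Any using (here; there)
open import Data.List.Relation.Unary.All using (All; []; _∷_)
open import Data.List.Relation.Unary.Linked using (Linked; []; [-]; _∷_)
open import Data.Product using (_,_; ∃-syntax)
open import Data.Sum as Sum using (_⊎_; inj₁; inj₂)
open import Function using (Equivalence)
open import Relation.Nullary using (yes; no; contradiction)
open import Relation.Binary.PropositionalEquality

select-max : ∀ a b → (if b <ᵇ a then a else b) ≡ a ⊔ b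
select-max a b with b <ᵇ a in eq
... | true  = sym (m≥n⇒m⊔n≡m (<⇒≤ (<ᵇ⇒< b a (subst T (sym eq) tt))))
... | false = sym (m≤n⇒m⊔n≡n (≮⇒≥ (λ b<a → subst T eq (<⇒<ᵇ b<a))))

largestLE-≤ : ∀ A r → largestLE A r ≤ r
largestLE-≤ []       r = z≤n
largestLE-≤ (a ∷ as) r with a ≤? r
... | no  _   = largestLE-≤ as r
... | yes a≤r rewrite select-max a (largestLE as r) = ⊔-lub a≤r (largestLE-≤ as r)

largestLE-∈ : ∀ A r → largestLE A r ≡ 0 ⊎ largestLE A r ∈ A
largestLE-∈ []       r = inj₁ refl
largestLE-∈ (a ∷ as) r with a ≤? r
... | no  _ = Sum.map₂ there (largestLE-∈ as r)
... | yes _ rewrite select-max a (largestLE as r) with ⊔-sel a (largestLE as r)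
...   | inj₁ e = subst (λ v → v ≡ 0 ⊎ v ∈ a ∷ as) (sym e) (inj₂ (here refl))
...   | inj₂ e = subst (λ v → v ≡ 0 ⊎ v ∈ a ∷ as) (sym e) (Sum.map₂ there (largestLE-∈ as r))

largestLE-maximal : ∀ A r a → a ∈ A → a ≤ r → a ≤ largestLE A r
largestLE-maximal (a′ ∷ as) r a a∈ a≤r with a′ ≤? r | a∈
... | no  a′≰r | here refl = contradiction a≤r a′≰r
... | no  _    | there a∈as = largestLE-maximal as r a a∈as a≤r
... | yes _    | here refl rewrite select-max a (largestLE as r) = m≤m⊔n a _
... | yes _    | there a∈as rewrite select-max a′ (largestLE as r) =
  ≤-trans (largestLE-maximal as r a a∈as a≤r) (m≤n⊔m a′ _)

largestLE-unique : ∀ A r v → v ∈ A → v ≤ r → (∀ a → a ∈ A → a ≤ r → a ≤ v) →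
                   largestLE A r ≡ v
largestLE-unique A r v v∈A v≤r v-max = ≤-antisym upper (largestLE-maximal A r v v∈A v≤r)
  where
  upper : largestLE A r ≤ v
  upper with largestLE-∈ A r
  ... | inj₁ e   = subst (_≤ v) (sym e) z≤n
  ... | inj₂ L∈A = v-max _ L∈A (largestLE-≤ A r)

-- A certificate of orderliness: a function F with F 0 = 0 that follows the
-- greedy recursion equals grd, and if adding a coin raises it by at most one it
-- bounds every representation from below, so grd is optimal.
module GreedyCertificate
  (A : List ℕ) (1∈A : 1 ∈ A) (F : ℕ → ℕ)
  (F-zero   : F 0 ≡ 0)
  (F-greedy : ∀ x → 0 < x → F x ≡ suc (F (x ∸ largestLE A x)))
  (F-coin   : ∀ a x → a ∈ A → F (a + x) ≤ suc (F x))
  where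

  -- Since 1 ∈ A, greedy always pays a genuine coin, so the remainder decreases.
  largest-pos : ∀ x → 0 < x → 0 < largestLE A x
  largest-pos x 0<x = largestLE-maximal A x 1 1∈A 0<x

  largest-∈ : ∀ x → 0 < x → largestLE A x ∈ A
  largest-∈ x 0<x with largestLE-∈ A x
  ... | inj₁ L≡0 = contradiction (subst (0 <_) L≡0 (largest-pos x 0<x)) (<-irrefl refl)
  ... | inj₂ L∈A = L∈A

  remainder-≤ : ∀ x → suc x ∸ largestLE A (suc x) ≤ x
  remainder-≤ x = ∸-monoʳ-≤ (suc x) (largest-pos (suc x) z<s)

  greedyCoins : ℕ → ℕ → List ℕ
  greedyCoins zero    x       = []
  greedyCoins (suc f) zero    = []
  greedyCoins (suc f) (suc x) =
    largestLE A (suc x) ∷ greedyCoins f (suc x ∸ largestLE A (suc x))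

  greedyCoins-length : ∀ f x → length (greedyCoins f x) ≡ grdF f A x
  greedyCoins-length zero    x       = refl
  greedyCoins-length (suc f) zero    = refl
  greedyCoins-length (suc f) (suc x) = cong suc (greedyCoins-length f _)

  greedyCoins-∈ : ∀ f x → All (_∈ A) (greedyCoins f x)
  greedyCoins-∈ zero    x       = []
  greedyCoins-∈ (suc f) zero    = []
  greedyCoins-∈ (suc f) (suc x) = largest-∈ (suc x) z<s ∷ greedyCoins-∈ f _

  greedyCoins-sum : ∀ f x → x ≤ f → sum (greedyCoins f x) ≡ x
  greedyCoins-sum zero    zero    _         = refl
  greedyCoins-sum (suc f) zero    _         = refl
  greedyCoins-sum (suc f) (suc x) (s≤s x≤f) = begin
    L + sum (greedyCoins f (suc x ∸ L)) ≡⟨ cong (L +_) (greedyCoins-sum f _ (≤-trans (remainder-≤ x) x≤f)) ⟩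
    L + (suc x ∸ L)                     ≡⟨ m+[n∸m]≡n (largestLE-≤ A (suc x)) ⟩
    suc x                               ∎
    where
    open ≡-Reasoning
    L = largestLE A (suc x)

  grdF≡F : ∀ f x → x ≤ f → grdF f A x ≡ F x
  grdF≡F zero    zero    _         = sym F-zero
  grdF≡F (suc f) zero    _         = sym F-zero
  grdF≡F (suc f) (suc x) (s≤s x≤f) =
    trans (cong suc (grdF≡F f _ (≤-trans (remainder-≤ x) x≤f))) (sym (F-greedy (suc x) z<s))

  F-lower : ∀ xs → All (_∈ A) xs → F (sum xs) ≤ length xs
  F-lower []       []         = ≤-reflexive F-zero
  F-lower (a ∷ xs) (a∈A ∷ ∈A) = ≤-trans (F-coin a (sum xs) a∈A) (s≤s (F-lower xs ∈A))

  greedy-is-rep : ∀ c → IsRep A c (greedyCoins c c)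
  greedy-is-rep c = greedyCoins-∈ c c , greedyCoins-sum c c ≤-refl

  greedy-is-minimal : ∀ c xs → IsRep A c xs → grd A c ≤ length xs
  greedy-is-minimal c xs (∈A , sum≡c) =
    subst (_≤ length xs) (trans (cong F sum≡c) (sym (grdF≡F c c ≤-refl))) (F-lower xs ∈A)

  orderly : Orderly A
  orderly c _ = (greedyCoins c c , greedy-is-rep c , greedyCoins-length c c) , greedy-is-minimal c

linked-applyUpTo : ∀ f → (∀ i → f i < f (suc i)) → ∀ n → Linked _<_ (applyUpTo f n)
linked-applyUpTo f f-step zero          = []
linked-applyUpTo f f-step (suc zero)    = [-]
linked-applyUpTo f f-step (suc (suc n)) =
  f-step 0 ∷ linked-applyUpTo (λ i → f (suc i)) (λ i → f-step (suc i)) (suc n)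

module Increasing (f : ℕ → ℕ) (f-step : ∀ i → f i < f (suc i)) where

  f-mono : ∀ {i j} → i ≤ j → f i ≤ f j
  f-mono {j = zero}  z≤n = ≤-refl
  f-mono {i} {suc j} i≤1+j with m≤n⇒m<n∨m≡n i≤1+j
  ... | inj₁ (s≤s i≤j) = ≤-trans (f-mono i≤j) (<⇒≤ (f-step j))
  ... | inj₂ refl      = ≤-refl

  isCurrency : f 0 ≡ 1 → ∀ n → IsCurrency (map f (upTo (suc n)))
  isCurrency f0≡1 n = f0≡1 , subst (Linked _<_) (sym (map-applyUpTo (λ i → i) f (suc n)))
                                    (linked-applyUpTo f f-step (suc n))

  largestLE-increasing : ∀ n j x → j ≤ n → f j ≤ x → (j < n → x < f (suc j)) →
                         largestLE (map f (upTo (suc n))) x ≡ f j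
  largestLE-increasing n j x j≤n fj≤x x<next =
    largestLE-unique _ x (f j) (∈-map⁺ f (∈-upTo⁺ (s≤s j≤n))) fj≤x below
    where
    below : ∀ a → a ∈ map f (upTo (suc n)) → a ≤ x → a ≤ f j
    below a a∈ a≤x with ∈-map⁻ f a∈
    ... | i , i∈ , refl with i ≤? j
    ...   | yes i≤j = f-mono i≤j
    ...   | no  i≰j = contradiction a≤x (<⇒≱ (<-≤-trans x<f[1+j] (f-mono j<i)))
      where
      j<i : j < i
      j<i = ≰⇒> i≰j
      x<f[1+j] : x < f (suc j)
      x<f[1+j] = x<next (<-≤-trans j<i (≤-pred (∈-upTo⁻ i∈)))

<ᵇ-true : ∀ {m n} → m < n → (m <ᵇ n) ≡ true
<ᵇ-true m<n = Equivalence.to T-≡ (<⇒<ᵇ m<n)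

<ᵇ-false : ∀ {m n} → m ≮ n → (m <ᵇ n) ≡ false
<ᵇ-false {m} {n} m≮n with m <ᵇ n in eq
... | false = refl
... | true  = contradiction (<ᵇ⇒< m n (subst T (sym eq) tt)) m≮n

coinA-below : ∀ l p i → i < l → coinA l p i ≡ suc i
coinA-below l p i i<l = cong (λ b → if b then suc i else (suc (i ∸ l) * p ∸ (i ∸ l)) * l) (<ᵇ-true i<l)

coinA-above : ∀ l p n → coinA l p (l + n) ≡ (suc n * p ∸ n) * l
coinA-above l p n = trans (cong (λ b → if b then suc (l + n) else (suc (l + n ∸ l) * p ∸ (l + n ∸ l)) * l) (<ᵇ-false (≤⇒≯ (m≤m+n l n))))
                          (cong (λ z → (suc z * p ∸ z) * l) (m+n∸m≡n l n))

-- (n+1)(q+1) - n = 1 + (n+1)q, i.e. a_{l+n} = (1 + (n+1)(p-1)) l.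
large-coin-arith : ∀ n q → suc n * suc q ∸ n ≡ suc (suc n * q)
large-coin-arith n q = begin
  suc n * suc q ∸ n     ≡⟨ cong (_∸ n) (*-suc (suc n) q) ⟩
  suc (n + suc n * q) ∸ n ≡⟨ cong (_∸ n) (sym (+-suc n _)) ⟩
  n + suc (suc n * q) ∸ n ≡⟨ m+n∸m≡n n _ ⟩
  suc (suc n * q)       ∎
  where open ≡-Reasoning

-- The coins of A_{l,m}(p) for l = l₀ + 1 and p = q + 1 with q = q₀ + 1.  Indexing
-- from l₀, the coins a_{l₀+j} = (1 + jq) l form the scaled second layer.
module Coins (l₀ q₀ : ℕ) where

  l q p : ℕ
  l = suc l₀
  q = suc q₀
  p = suc q

  coin : ℕ → ℕ
  coin = coinA l p

  coin-small : ∀ {i} → i < l → coin i ≡ suc i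
  coin-small {i} = coinA-below l p i

  coin-large : ∀ j → coin (l₀ + j) ≡ suc (j * q) * l
  coin-large zero    = coin-small (s≤s (≤-reflexive (+-identityʳ l₀)))
  coin-large (suc n) = begin
    coin (l₀ + suc n)        ≡⟨ cong coin (+-suc l₀ n) ⟩
    coin (l + n)             ≡⟨ coinA-above l p n ⟩
    (suc n * p ∸ n) * l      ≡⟨ cong (_* l) (large-coin-arith n q) ⟩
    suc (suc n * q) * l      ∎
    where open ≡-Reasoning

  index-split : ∀ i → i < l₀ ⊎ ∃[ j ] i ≡ l₀ + j
  index-split i with i <? l₀
  ... | yes i<l₀ = inj₁ i<l₀
  ... | no  i≮l₀ = inj₂ (i ∸ l₀ , sym (m+[n∸m]≡n (≮⇒≥ i≮l₀)))

  -- The coins strictly increase (this is where p ≥ 2 is used).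
  coin-step : ∀ i → coin i < coin (suc i)
  coin-step i with index-split i
  ... | inj₁ i<l₀ = subst₂ _<_ (sym (coin-small (m<n⇒m<1+n i<l₀))) (sym (coin-small (s≤s i<l₀))) (n<1+n (suc i))
  ... | inj₂ (j , refl) = begin-strict
    coin (l₀ + j)         ≡⟨ coin-large j ⟩
    suc (j * q) * l       <⟨ *-monoˡ-< l (s≤s (m<n+m (j * q) {q} z<s)) ⟩
    suc (suc j * q) * l   ≡⟨ coin-large (suc j) ⟨
    coin (l₀ + suc j)     ≡⟨ cong coin (+-suc l₀ j) ⟩
    coin (suc (l₀ + j))   ∎
    where open ≤-Reasoning

data Euclid (n : ℕ) : ℕ → Set where
  euclid : ∀ t s → s < n → Euclid n (t * n + s)

euclid-view : ∀ n .{{_ : NonZero n}} y → Euclid n y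
euclid-view n y = subst (Euclid n) (sym (trans (m≡m%n+[m/n]*n y n) (+-comm (y % n) _)))
                        (euclid (y / n) (y % n) (m%n<n y n))

euclid-/ : ∀ n .{{_ : NonZero n}} t {s} → s < n → (t * n + s) / n ≡ t
euclid-/ n t {s} s<n = begin
  (t * n + s) / n     ≡⟨ +-distrib-/-∣ˡ s (n∣m*n t) ⟩
  t * n / n + s / n   ≡⟨ cong₂ _+_ (m*n/n≡m t n) (m<n⇒m/n≡0 s<n) ⟩
  t + 0               ≡⟨ +-identityʳ t ⟩
  t                   ∎
  where open ≡-Reasoning

euclid-% : ∀ n .{{_ : NonZero n}} t {s} → s < n → (t * n + s) % n ≡ s
euclid-% n t {s} s<n = begin
  (t * n + s) % n ≡⟨ cong (_% n) (+-comm (t * n) s) ⟩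
  (s + t * n) % n ≡⟨ [m+kn]%n≡m%n s t n ⟩
  s % n           ≡⟨ m<n⇒m%n≡m s<n ⟩
  s               ∎
  where open ≡-Reasoning

add-to-digit : ∀ a u r → a + (u + r) ≡ u + (r + a)
add-to-digit a u r = trans (+-comm a (u + r)) (+-assoc u r a)

-- The second layer, divided by l: coins 1 + jq for 0 ≤ j ≤ K, the largest being
-- C = 1 + Kq.  For y = t C + s (s < C) greedy uses t coins C and h s coins for s,
-- and G y counts them.
module Layer (q : ℕ) .{{_ : NonZero q}} (K : ℕ) where

  C : ℕ
  C = suc (K * q)

  -- greedy count of a digit s < C: one coin 1 + jq, then (s - 1) mod q ones
  h : ℕ → ℕ
  h zero    = 0
  h (suc s) = suc (s % q)

  G : ℕ → ℕ
  G y = y / C + h (y % C)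

  G-eval : ∀ t {s} → s < C → G (t * C + s) ≡ t + h s
  G-eval t s<C = cong₂ _+_ (euclid-/ C t s<C) (cong h (euclid-% C t s<C))

  h-id : ∀ s → s ≤ q → h s ≡ s
  h-id zero    _   = refl
  h-id (suc s) s<q = cong suc (m<n⇒m%n≡m s<q)

  h-mod : ∀ s → s % q ≤ h s
  h-mod zero    = m%n≤m 0 q
  h-mod (suc s) = begin
    suc s % q             ≡⟨ %-distribˡ-+ 1 s q ⟩
    (1 % q + s % q) % q   ≤⟨ m%n≤m _ q ⟩
    1 % q + s % q         ≤⟨ +-monoˡ-≤ (s % q) (m%n≤m 1 q) ⟩
    suc (s % q)           ∎
    where open ≤-Reasoning

  h-step : ∀ s j → h (s + suc (j * q)) ≤ suc (h s)
  h-step s j = begin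
    h (s + suc (j * q))   ≡⟨ cong h (+-suc s (j * q)) ⟩
    suc ((s + j * q) % q) ≡⟨ cong suc ([m+kn]%n≡m%n s j q) ⟩
    suc (s % q)           ≤⟨ s≤s (h-mod s) ⟩
    suc (h s)             ∎
    where open ≤-Reasoning

  h-shift : ∀ w d → h w ≤ h (w + d * q)
  h-shift zero    d = z≤n
  h-shift (suc w) d = ≤-reflexive (cong suc (sym ([m+kn]%n≡m%n w d q)))

  G-coin-no-carry : ∀ t {s} j → s < C → s + suc (j * q) < C →
                    G (suc (j * q) + (t * C + s)) ≤ suc (G (t * C + s))
  G-coin-no-carry t {s} j s<C fits = begin
    G (c + (t * C + s))   ≡⟨ cong G (add-to-digit c (t * C) s) ⟩
    G (t * C + (s + c))   ≡⟨ G-eval t fits ⟩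
    t + h (s + c)         ≤⟨ +-monoʳ-≤ t (h-step s j) ⟩
    t + suc (h s)         ≡⟨ +-suc t (h s) ⟩
    suc (t + h s)         ≡⟨ cong suc (G-eval t s<C) ⟨
    suc (G (t * C + s))   ∎
    where
    open ≤-Reasoning
    c = suc (j * q)

  -- Adding c = 1 + jq with carry: t grows by one and the new digit
  -- w = s + c - C = s - (K - j) q needs no more coins than s.
  G-coin-carry : ∀ t {s} j → j ≤ K → s < C → C ≤ s + suc (j * q) →
                 G (suc (j * q) + (t * C + s)) ≤ suc (G (t * C + s))
  G-coin-carry t {s} j j≤K s<C overflow = begin
    G (c + (t * C + s))   ≡⟨ cong G carry ⟩
    G (suc t * C + w)     ≡⟨ G-eval (suc t) w<C ⟩
    suc t + h w           ≤⟨ s≤s (+-monoʳ-≤ t hw≤hs) ⟩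
    suc (t + h s)         ≡⟨ cong suc (G-eval t s<C) ⟨
    suc (G (t * C + s))   ∎
    where
    open ≤-Reasoning
    c = suc (j * q)
    w = s + c ∸ C
    C+w≡s+c : C + w ≡ s + c
    C+w≡s+c = m+[n∸m]≡n overflow
    carry : c + (t * C + s) ≡ suc t * C + w
    carry = begin-equality
      c + (t * C + s)     ≡⟨ add-to-digit c (t * C) s ⟩
      t * C + (s + c)     ≡⟨ cong (t * C +_) C+w≡s+c ⟨
      t * C + (C + w)     ≡⟨ +-assoc (t * C) C w ⟨
      (t * C + C) + w     ≡⟨ cong (_+ w) (+-comm (t * C) C) ⟩
      suc t * C + w       ∎
    w<C : w < C
    w<C = +-cancelˡ-< C w C (subst (_< C + C) (sym C+w≡s+c) (+-mono-<-≤ s<C (s≤s (*-monoˡ-≤ q j≤K))))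
    s≡w+dq : w + (K ∸ j) * q ≡ s
    s≡w+dq = +-cancelʳ-≡ (j * q) _ _ (begin-equality
      w + (K ∸ j) * q + j * q     ≡⟨ +-assoc w _ _ ⟩
      w + ((K ∸ j) * q + j * q)   ≡⟨ cong (w +_) (*-distribʳ-+ q (K ∸ j) j) ⟨
      w + (K ∸ j + j) * q         ≡⟨ cong (λ z → w + z * q) (m∸n+n≡m j≤K) ⟩
      w + K * q                   ≡⟨ +-comm w _ ⟩
      K * q + w                   ≡⟨ suc-injective (trans C+w≡s+c (+-suc s (j * q))) ⟩
      s + j * q                   ∎)
    hw≤hs : h w ≤ h s
    hw≤hs = subst (λ z → h w ≤ h z) s≡w+dq (h-shift w (K ∸ j))

  G-coin : ∀ j y → j ≤ K → G (suc (j * q) + y) ≤ suc (G y)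
  G-coin j y j≤K with euclid-view C y
  ... | euclid t s s<C with s + suc (j * q) <? C
  ...   | yes fits     = G-coin-no-carry t j s<C fits
  ...   | no  overflow = G-coin-carry t j j≤K s<C (≮⇒≥ overflow)

  record GreedyStep (y : ℕ) : Set where
    field
      j        : ℕ
      j≤K      : j ≤ K
      unit≤y   : suc (j * q) ≤ y
      y<next   : j < K → y < suc (suc j * q)
      G-step   : G y ≡ suc (G (y ∸ suc (j * q)))

  -- If y ≥ C greedy pays C; otherwise y = 1 + e pays 1 + ⌊e/q⌋q, leaving e mod q.
  G-greedy : ∀ y → 0 < y → GreedyStep y
  G-greedy y 0<y with euclid-view C y
  ... | euclid zero    zero    _   = contradiction 0<y (<-irrefl refl)
  ... | euclid (suc t) s       s<C = record
    { j      = K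
    ; j≤K    = ≤-refl
    ; unit≤y = ≤-trans (m≤m+n C (t * C)) (m≤m+n _ s)
    ; y<next = λ K<K → contradiction K<K (<-irrefl refl)
    ; G-step = begin
        G (suc t * C + s)           ≡⟨ G-eval (suc t) s<C ⟩
        suc (t + h s)               ≡⟨ cong suc (G-eval t s<C) ⟨
        suc (G (t * C + s))         ≡⟨ cong (λ z → suc (G z)) (m+n∸m≡n C (t * C + s)) ⟨
        suc (G (C + (t * C + s) ∸ C)) ≡⟨ cong (λ z → suc (G (z ∸ C))) (+-assoc C (t * C) s) ⟨
        suc (G (suc t * C + s ∸ C)) ∎
    }
    where open ≡-Reasoning
  ... | euclid zero    (suc e) s<C = record
    { j      = j
    ; j≤K    = <⇒≤ j<K
    ; unit≤y = s≤s (m/n*n≤m e q)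
    ; y<next = λ _ → s≤s (subst (_< q + j * q) (sym e≡) (+-monoˡ-< (j * q) (m%n<n e q)))
    ; G-step = begin
        G (suc e)                   ≡⟨ G-eval 0 s<C ⟩
        suc (e % q)                 ≡⟨ cong suc (h-id (e % q) (<⇒≤ (m%n<n e q))) ⟨
        suc (h (e % q))             ≡⟨ cong suc (G-eval 0 (<-trans (s≤s (m%n≤m e q)) s<C)) ⟨
        suc (G (e % q))             ≡⟨ cong (λ z → suc (G z)) (m%n≡m∸m/n*n e q) ⟩
        suc (G (e ∸ j * q))         ∎
    }
    where
    open ≡-Reasoning
    j = e / q
    e≡ : e ≡ e % q + j * q
    e≡ = m≡m%n+[m/n]*n e q
    j<K : j < K
    j<K = *-cancelʳ-< q j K (≤-<-trans (m/n*n≤m e q) (≤-pred s<C))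

digits-< : ∀ {y d r} l → r < l → y < d → y * l + r < d * l
digits-< {y} {d} {r} l r<l y<d = begin-strict
  y * l + r   <⟨ +-monoʳ-< (y * l) r<l ⟩
  y * l + l   ≡⟨ +-comm (y * l) l ⟩
  suc y * l   ≤⟨ *-monoˡ-≤ l y<d ⟩
  d * l       ∎
  where open ≤-Reasoning

ceilDiv-unique : ∀ a b n → a ≤ n * suc b → n * suc b < a + suc b → ceilDiv a (suc b) ≡ n
ceilDiv-unique a b n a≤nB nB<a+B = ≤-antisym (≤-pred quotient<1+n) n≤quotient
  where
  nB≤a+b : n * suc b ≤ a + b
  nB≤a+b = ≤-pred (subst (n * suc b <_) (+-suc a b) nB<a+B)
  quotient<1+n : (a + b) / suc b < suc n
  quotient<1+n = m<n*o⇒m/o<n (begin-strict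
    a + b           ≤⟨ +-monoˡ-≤ b a≤nB ⟩
    n * suc b + b   <⟨ +-monoʳ-< (n * suc b) (n<1+n b) ⟩
    n * suc b + suc b ≡⟨ +-comm (n * suc b) (suc b) ⟩
    suc n * suc b   ∎)
    where open ≤-Reasoning
  n≤quotient : n ≤ (a + b) / suc b
  n≤quotient = subst (_≤ (a + b) / suc b) (m*n/n≡m n (suc b)) (/-monoˡ-≤ (suc b) nB≤a+b)

-- ⌈(1 + (k+1)q) / (1 + q)⌉ = k + 1 rests on this identity.
ceiling-identity : ∀ k q → (k + 1) * suc (1 * q) ≡ suc (suc k * q) + k
ceiling-identity = solve-∀

-- The number of first-layer coins paying a digit r < l: none or the coin r itself.
nonzero : ℕ → ℕ
nonzero zero    = 0
nonzero (suc _) = 1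

nonzero≤1 : ∀ r → nonzero r ≤ 1
nonzero≤1 zero    = z≤n
nonzero≤1 (suc _) = ≤-refl

nonzero-pos : ∀ {r} → 0 < r → nonzero r ≡ 1
nonzero-pos {suc _} _ = refl

module Orderliness (l₀ q₀ m : ℕ) (l≤m : suc l₀ ≤ m) where

  open Coins l₀ q₀

  k K : ℕ
  k = m ∸ l
  K = suc k

  open Layer q K

  A : List ℕ
  A = currA l m p

  l₀+K≡m : l₀ + K ≡ m
  l₀+K≡m = trans (+-suc l₀ k) (m+[n∸m]≡n l≤m)

  F : ℕ → ℕ
  F x = G (x / l) + nonzero (x % l)

  F-eval : ∀ y {r} → r < l → F (y * l + r) ≡ G y + nonzero r
  F-eval y r<l = cong₂ _+_ (cong G (euclid-/ l y r<l)) (cong nonzero (euclid-% l y r<l))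

  coin∈A : ∀ {i} → i ≤ m → coin i ∈ A
  coin∈A i≤m = ∈-map⁺ coin (∈-upTo⁺ (s≤s i≤m))

  coin-index : ∀ {a} → a ∈ A → ∃[ i ] i ≤ m × a ≡ coin i
  coin-index a∈A with ∈-map⁻ coin {xs = upTo (suc m)} a∈A
  ... | i , i∈ , a≡ = i , ≤-pred (∈-upTo⁻ i∈) , a≡

  largest-coin : ∀ {x} i → i ≤ m → coin i ≤ x → (i < m → x < coin (suc i)) → largestLE A x ≡ coin i
  largest-coin {x} i = Increasing.largestLE-increasing coin coin-step m i x

  F-large-coin : ∀ j y {r} → r < l → j ≤ K → F (coin (l₀ + j) + (y * l + r)) ≤ suc (F (y * l + r))
  F-large-coin j y {r} r<l j≤K = begin
    F (coin (l₀ + j) + (y * l + r)) ≡⟨ cong (λ a → F (a + (y * l + r))) (coin-large j) ⟩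
    F (c * l + (y * l + r))         ≡⟨ cong F (+-assoc (c * l) (y * l) r) ⟨
    F (c * l + y * l + r)           ≡⟨ cong (λ z → F (z + r)) (*-distribʳ-+ l c y) ⟨
    F ((c + y) * l + r)             ≡⟨ F-eval (c + y) r<l ⟩
    G (c + y) + nonzero r                 ≤⟨ +-monoˡ-≤ (nonzero r) (G-coin j y j≤K) ⟩
    suc (G y + nonzero r)                 ≡⟨ cong suc (F-eval y r<l) ⟨
    suc (F (y * l + r))             ∎
    where
    open ≤-Reasoning
    c = suc (j * q)

  -- Paying a coin i + 1 < l raises F by at most one; when it carries into the
  -- second layer this is the unit coin l = l (1 + 0q), and the digit r was nonzero.
  F-small-coin : ∀ i y {r} → i < l₀ → r < l → F (coin i + (y * l + r)) ≤ suc (F (y * l + r))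
  F-small-coin i y {r} i<l₀ r<l with r + suc i <? l
  ... | yes fits = begin
    F (coin i + (y * l + r))  ≡⟨ cong (λ a → F (a + (y * l + r))) (coin-small (m<n⇒m<1+n i<l₀)) ⟩
    F (suc i + (y * l + r))   ≡⟨ cong F (add-to-digit (suc i) (y * l) r) ⟩
    F (y * l + (r + suc i))   ≡⟨ F-eval y fits ⟩
    G y + nonzero (r + suc i)       ≤⟨ +-monoʳ-≤ (G y) (≤-trans (nonzero≤1 _) (s≤s z≤n)) ⟩
    G y + suc (nonzero r)           ≡⟨ +-suc (G y) (nonzero r) ⟩
    suc (G y + nonzero r)           ≡⟨ cong suc (F-eval y r<l) ⟨
    suc (F (y * l + r))       ∎
    where open ≤-Reasoning
  ... | no overflow = begin
    F (coin i + (y * l + r))  ≡⟨ cong (λ a → F (a + (y * l + r))) (coin-small (m<n⇒m<1+n i<l₀)) ⟩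
    F (suc i + (y * l + r))   ≡⟨ cong F carry ⟩
    F (suc y * l + r′)        ≡⟨ F-eval (suc y) r′<l ⟩
    G (suc y) + nonzero r′          ≤⟨ +-mono-≤ (G-coin 0 y z≤n) (≤-trans (nonzero≤1 r′) (≤-reflexive (sym (nonzero-pos 0<r)))) ⟩
    suc (G y + nonzero r)           ≡⟨ cong suc (F-eval y r<l) ⟨
    suc (F (y * l + r))       ∎
    where
    open ≤-Reasoning
    0<r : 0 < r
    0<r = ≰⇒> λ r≤0 → overflow (≤-<-trans (+-monoˡ-≤ (suc i) r≤0) (s≤s i<l₀))
    r′ = r + suc i ∸ l
    l+r′≡r+i : l + r′ ≡ r + suc i
    l+r′≡r+i = m+[n∸m]≡n (≮⇒≥ overflow)
    r′<l : r′ < l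
    r′<l = +-cancelˡ-< l r′ l (subst (_< l + l) (sym l+r′≡r+i) (+-mono-<-≤ r<l (<⇒≤ (s≤s i<l₀))))
    carry : suc i + (y * l + r) ≡ suc y * l + r′
    carry = begin-equality
      suc i + (y * l + r)   ≡⟨ add-to-digit (suc i) (y * l) r ⟩
      y * l + (r + suc i)   ≡⟨ cong (y * l +_) l+r′≡r+i ⟨
      y * l + (l + r′)      ≡⟨ +-assoc (y * l) l r′ ⟨
      y * l + l + r′        ≡⟨ cong (_+ r′) (+-comm (y * l) l) ⟩
      suc y * l + r′        ∎

  F-coin : ∀ a x → a ∈ A → F (a + x) ≤ suc (F x)
  F-coin a x a∈A with coin-index a∈A | euclid-view l x
  ... | i , i≤m , refl | euclid y r r<l with index-split i
  ...   | inj₁ i<l₀        = F-small-coin i y i<l₀ r<l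
  ...   | inj₂ (j , refl) = F-large-coin j y r<l (+-cancelˡ-≤ l₀ j K (subst (l₀ + j ≤_) (sym l₀+K≡m) i≤m))

  F-greedy-large : ∀ y {r} → r < l → 0 < y →
                   F (y * l + r) ≡ suc (F (y * l + r ∸ largestLE A (y * l + r)))
  F-greedy-large y {r} r<l 0<y = begin
    F (y * l + r)                 ≡⟨ F-eval y r<l ⟩
    G y + nonzero r                     ≡⟨ cong (_+ nonzero r) G-step ⟩
    suc (G (y ∸ c) + nonzero r)         ≡⟨ cong suc (F-eval (y ∸ c) r<l) ⟨
    suc (F ((y ∸ c) * l + r))     ≡⟨ cong (λ z → suc (F z)) pay ⟨
    suc (F (y * l + r ∸ c * l))   ≡⟨ cong (λ z → suc (F (y * l + r ∸ z))) (trans (sym (coin-large j)) (sym largest)) ⟩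
    suc (F (y * l + r ∸ largestLE A (y * l + r))) ∎
    where
    open ≡-Reasoning
    open GreedyStep (G-greedy y 0<y)
    c = suc (j * q)
    pay : y * l + r ∸ c * l ≡ (y ∸ c) * l + r
    pay = trans (+-∸-comm r (*-monoˡ-≤ l unit≤y)) (cong (_+ r) (sym (*-distribʳ-∸ l y c)))
    j<K : l₀ + j < m → j < K
    j<K i<m = +-cancelˡ-< l₀ j K (subst (l₀ + j <_) (sym l₀+K≡m) i<m)
    next-coin : suc (suc j * q) * l ≡ coin (suc (l₀ + j))
    next-coin = trans (sym (coin-large (suc j))) (cong coin (+-suc l₀ j))
    largest : largestLE A (y * l + r) ≡ coin (l₀ + j)
    largest = largest-coin (l₀ + j) (subst (l₀ + j ≤_) l₀+K≡m (+-monoʳ-≤ l₀ j≤K))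
      (subst (_≤ y * l + r) (sym (coin-large j)) (≤-trans (*-monoˡ-≤ l unit≤y) (m≤m+n _ r)))
      (λ i<m → subst (y * l + r <_) next-coin (digits-< l r<l (y<next (j<K i<m))))

  F-greedy : ∀ x → 0 < x → F x ≡ suc (F (x ∸ largestLE A x))
  F-greedy x 0<x with euclid-view l x
  ... | euclid zero    zero     _   = contradiction 0<x (<-irrefl refl)
  ... | euclid (suc y) r        r<l = F-greedy-large (suc y) r<l z<s
  ... | euclid zero    (suc r₀) r<l = begin
    F (suc r₀)                               ≡⟨ F-eval 0 r<l ⟩
    suc (F 0)                                ≡⟨ cong (λ z → suc (F z)) (n∸n≡0 r₀) ⟨
    suc (F (suc r₀ ∸ suc r₀))                ≡⟨ cong (λ z → suc (F (suc r₀ ∸ z))) (trans (sym (coin-small r₀<l)) (sym largest)) ⟩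
    suc (F (suc r₀ ∸ largestLE A (suc r₀)))  ∎
    where
    open ≡-Reasoning
    r₀<l : r₀ < l
    r₀<l = <-trans (n<1+n r₀) r<l
    largest : largestLE A (suc r₀) ≡ coin r₀
    largest = largest-coin r₀ (≤-trans (<⇒≤ r₀<l) l≤m) (≤-reflexive (coin-small r₀<l))
      (λ _ → subst (suc r₀ <_) (sym (coin-small r<l)) (n<1+n (suc r₀)))

  isCurrency : IsCurrency A
  isCurrency = Increasing.isCurrency coin coin-step refl m

  orderly : Orderly A
  orderly = GreedyCertificate.orderly A (coin∈A z≤n) F refl F-greedy F-coin

  ceiling : k < p → ceilDiv (coin m) (coin l) ≡ k + 1
  ceiling k<p = begin
    ceilDiv (coin m) (coin l)   ≡⟨ cong₂ ceilDiv top-coin unit-coin ⟩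
    ceilDiv (U * l) (V * l)     ≡⟨ ceilDiv-unique (U * l) _ (k + 1) upper lower ⟩
    k + 1                       ∎
    where
    open ≡-Reasoning
    U V : ℕ
    U = suc (K * q)
    V = suc (1 * q)
    top-coin : coin m ≡ U * l
    top-coin = trans (cong coin (sym l₀+K≡m)) (coin-large K)
    unit-coin : coin l ≡ V * l
    unit-coin = trans (cong coin (+-comm 1 l₀)) (coin-large 1)
    scaled : (k + 1) * (V * l) ≡ (U + k) * l
    scaled = trans (sym (*-assoc (k + 1) V l)) (cong (_* l) (ceiling-identity k q))
    k<V : k < V
    k<V = s≤s (subst (k ≤_) (sym (*-identityˡ q)) (≤-pred k<p))
    upper : U * l ≤ (k + 1) * (V * l)
    upper = subst (U * l ≤_) (sym scaled) (*-monoˡ-≤ l (m≤m+n U k))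
    lower : (k + 1) * (V * l) < U * l + V * l
    lower = subst₂ _<_ (sym scaled) (*-distribʳ-+ l U V) (*-monoˡ-< l (+-monoʳ-< U k<V))

lemma7p3 : ∀ (l m p : ℕ) → 2 ≤ l → l < m → 2 ≤ p →
    (IsCurrency (currA l m p) × Orderly (currA l m p))
    × (m ∸ l < p → ceilDiv (coinA l p m) (coinA l p l) ≡ m ∸ l + 1)
lemma7p3 (suc l₀) m (suc (suc q₀)) _ l<m _ = (isCurrency , orderly) , ceiling
  where open Orderliness l₀ q₀ m (<⇒≤ l<m)
lemma7p3 zero    _ _          () _ _
lemma7p3 (suc _) _ zero       _  _ ()
lemma7p3 (suc _) _ (suc zero) _  _ (s≤s ())
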